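{- Let $n \geq 2$ and let $k$ be an integer with $\lceil n/2 \rceil + 1 \leq k \leq n$. Then every $G$-orbit of level $1$ contained in $IM(k)$ contains exactly one element of multiplicity $1$ and has exactly $\phi(n)$ elements. Moreover, $IM(k)$ contains exactly $p(n-k)$ $G$-orbits of level $1$, and hence exactly $\phi(n)\,p(n-k)$ solutions of level $1$. In particular, for every $k$ with $\lfloor n/2 \rfloor + 2 \leq k \leq n$, the set $IM(k)$ contains exactly $p(n-k)$ $G$-orbits of level $1$.
   Context: Let $\mathbb{N}=\{0,1,2,\ldots\}$ and $n\ge 2$. Let $M=\{(a_1,\ldots,a_{n-1})\in\mathbb{N}^{n-1} : a_1+2a_2+\cdots+(n-1)a_{n-1}\equiv 0 \pmod n\}$, a monoid under componentwise addition. A nonzero $A\in M$ is decomposable if $A=B+C$ with $B,C\in M$ both nonzero, and indecomposable otherwise; $IM$ is the set of indecomposable solutions. The degree of $A$ is $\deg(A)=a_1+\cdots+a_{n-1}$, and $IM(k)$ is the set of indecomposable solutions of degree $k$. The multiplicity of $A$ is $m(A)=(a_1+2a_2+\cdots+(n-1)a_{n-1})/n$. Let $G=\mathrm{Aut}(\mathbb{Z}/n\mathbb{Z})$, represented by the integers $1\le g\le n-1$ with $\gcd(g,n)=1$, so $|G|=\phi(n)$ (Euler's totient). For such $g$ let $\sigma_g$ be the permutation of $\{1,\ldots,n-1\}$ with $\sigma_g(i)\equiv gi \pmod n$, and define $g\cdot A=(a_{\sigma_g^{ -1}(1)},\ldots,a_{\sigma_g^{ -1}(n-1)})$; this is an action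 of $G$ on $M$ preserving degree and indecomposability. The level of $A$ is $\ell(A)=\min\{m(g\cdot A): g\in G\}$ (constant on $G$-orbits). $p(t)$ denotes the number of partitions of the integer $t$; $\lfloor x\rfloor$ is the floor and $\lceil n/2\rceil = n-\lfloor n/2\rfloor$. -}

module Defs where

open import Data.Nat using (ℕ; zero; suc; _+_; _*_; _∸_; _⊓_; _≤_; _<_; ⌊_/2⌋; ⌈_/2⌉)
open import Data.Nat.DivMod using (_/_; _%_)
open import Data.Nat.Divisibility using (_∣_)
open import Data.Nat.Coprimality using (coprime?)
open import Data.Nat.Properties using (_≟_)
open import Data.Fin using (Fin; toℕ)
open import Data.Vec using (Vec; lookup; tabulate; zipWith; replicate; allFin; toList)
import Data.Vec as Vec
open import Data.List using (List; []; _∷_; length; map; foldr; filter; applyUpTo)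
import Data.List as List
open import Data.List.Membership.Propositional using (_∈_)
open import Data.List.Relation.Unary.All using (All)
open import Data.List.Relation.Unary.Any using (Any)
open import Data.List.Relation.Unary.AllPairs using (AllPairs)
open import Data.List.Relation.Unary.Unique.Propositional using (Unique)
open import Data.Product using (Σ; ∃; ∃-syntax; _×_; _,_)
open import Relation.Nullary using (¬_; yes; no)
open import Relation.Binary.PropositionalEquality using (_≡_; _≢_)
open import Function.Bundles using (_⇔_)

-- A solution candidate: (a_1, …, a_{n-1}); Fin index j stands for i = toℕ j + 1.
Sol : ℕ → Set
Sol n = Vec ℕ (n ∸ 1)

weightFrom : ∀ {m} → ℕ → Vec ℕ m → ℕ
weightFrom c Vec.[] = 0
weightFrom c (x Vec.∷ xs) = c * x + weightFrom (suc c) xs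

weight : ∀ {m} → Vec ℕ m → ℕ
weight = weightFrom 1

InM : (n : ℕ) → Sol n → Set
InM n A = n ∣ weight A

zeroSol : (n : ℕ) → Sol n
zeroSol n = replicate _ 0

addSol : (n : ℕ) → Sol n → Sol n → Sol n
addSol n = zipWith _+_

Decomposable : (n : ℕ) → Sol n → Set
Decomposable n A = ∃[ B ] ∃[ C ]
  (InM n B × InM n C × B ≢ zeroSol n × C ≢ zeroSol n × A ≡ addSol n B C)

Indecomposable : (n : ℕ) → Sol n → Set
Indecomposable n A = InM n A × A ≢ zeroSol n × ¬ Decomposable n A

deg : ∀ {m} → Vec ℕ m → ℕ
deg = Vec.sum

IM : (n k : ℕ) → Sol n → Set
IM n k A = Indecomposable n A × deg A ≡ k

mult : (n : ℕ) → Sol n → ℕ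
mult zero A = 0
mult (suc n) A = weight A / suc n

modN : ℕ → ℕ → ℕ
modN zero x = x
modN (suc n) x = x % suc n

-- G = Aut(Z/nZ) as the list of 1 ≤ g ≤ n-1 with gcd(g,n) = 1
units : ℕ → List ℕ
units n = filter (λ g → coprime? g n) (applyUpTo suc (n ∸ 1))

φ : ℕ → ℕ
φ n = length (units n)

findFirst : ∀ {m} → Fin m → (Fin m → ℕ) → ℕ → List (Fin m) → Fin m
findFirst d f t [] = d
findFirst d f t (i ∷ is) with f i ≟ t
... | yes _ = i
... | no _ = findFirst d f t is

-- σ_g^{-1}(j): the index i ∈ {1..n-1} with g*i ≡ j (mod n)
σinv : (n g : ℕ) → Fin (n ∸ 1) → Fin (n ∸ 1)
σinv n g j = findFirst j (λ i → modN n (g * suc (toℕ i))) (suc (toℕ j)) (toList (allFin _))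

act : (n g : ℕ) → Sol n → Sol n
act n g A = tabulate (λ j → lookup A (σinv n g j))

-- ℓ(A) = min over g ∈ G of m(g·A)  (seeded with m(A) = m(1·A), 1 ∈ G for n ≥ 2)
level : (n : ℕ) → Sol n → ℕ
level n A = foldr _⊓_ (mult n A) (map (λ g → mult n (act n g A)) (units n))

InOrbit : (n : ℕ) → Sol n → Sol n → Set
InOrbit n A B = ∃[ g ] (g ∈ units n × B ≡ act n g A)

-- partitions: parts f t m = # partitions of t into parts of size ≤ m (fuel f ≥ t)
sumTo : ℕ → (ℕ → ℕ) → ℕ
sumTo zero h = 0
sumTo (suc j) h = h (suc j) + sumTo j h

parts : ℕ → ℕ → ℕ → ℕ
parts _ zero m = 1
parts zero (suc t) m = 0
parts (suc f) (suc t) m = sumTo (suc t ⊓ m) (λ j → parts f (suc t ∸ j) j)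

p : ℕ → ℕ
p t = parts t t t

-- IM(k) contains exactly N G-orbits of level 1 (given by a list of
-- pairwise non-conjugate representatives covering all level-1 elements)
Level1OrbitCount : (n k N : ℕ) → Set
Level1OrbitCount n k N = ∃[ R ]
  ( All (λ A → IM n k A × level n A ≡ 1) R
  × AllPairs (λ A B → ¬ InOrbit n A B) R
  × (∀ A → IM n k A → level n A ≡ 1 → Any (λ B → InOrbit n B A) R)
  × length R ≡ N )

OrbitSize : (n : ℕ) → Sol n → ℕ → Set
OrbitSize n A N = ∃[ L ] (Unique L × (∀ B → (B ∈ L) ⇔ InOrbit n A B) × length L ≡ N)

UniqueMult1InOrbit : (n : ℕ) → Sol n → Set
UniqueMult1InOrbit n A = ∃[ B ] (InOrbit n A B × mult n B ≡ 1
  × (∀ C → InOrbit n A C → mult n C ≡ 1 → C ≡ B))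

Level1Count : (n k N : ℕ) → Set
Level1Count n k N = ∃[ S ] (Unique S × (∀ A → (A ∈ S) ⇔ (IM n k A × level n A ≡ 1)) × length S ≡ N)

{-# OPTIONS --safe #-}
-- A solution has multiplicity one iff it has weight a₁ + 2a₂ + ⋯ = n; such a vector is
-- indecomposable, and a solution has level one iff its G-orbit contains one.  For B of
-- weight n and degree k, Σ_{i ≥ 2} (i - 2) a_i = a₁ - (2k - n), so 2k ≥ n + 2 makes B
-- rigid: if u·B also had weight n for a unit u ≠ 1, then with v = u⁻¹ the entries a₁ and
-- a_v trade places, and the identity for B and for u·B gives a₁ ≥ 2 + a_v ≥ 4 + a₁ when
-- u, v ≥ 3, while u = 2 forces 2v ≡ 1 (mod n) and then k ≥ 2v > n (likewise v = 2).  So a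
-- level-one orbit contains exactly one vector of multiplicity one and has trivial
-- stabiliser, hence φ(n) elements; these vectors are (k - deg c, c) with c running over
-- the partitions of n - k, c_i counting the parts equal to i - 1.
module Submission where

open import Defs
open import Data.Nat
  using (ℕ; zero; suc; _+_; _*_; _∸_; _⊓_; _≤_; _<_; z≤n; s≤s; s≤s⁻¹; NonZero; >-nonZero; ⌊_/2⌋; ⌈_/2⌉)
open import Data.Nat.Properties
open import Data.Nat.DivMod
  using (_%_; _/_; %-distribˡ-+; %-distribˡ-*; [m+kn]%n≡m%n; m%n%n≡m%n; m≡m%n+[m/n]*n; m<n⇒m%n≡m; m%n<n;
         n/n≡1; m*n/n≡m; m≥n⇒m/n>0)
open import Data.Nat.Divisibility
  using (_∣_; divides; ∣-trans; ∣-refl; ∣m+n∣m⇒∣n; ∣1⇒≡1; n∣m*n; m∣m*n; ∣⇒≤; m%n≡0⇒n∣m; n∣m⇒m%n≡0)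
open import Data.Nat.Coprimality using (Coprime; coprime?; coprime-Bézout)
open import Data.Nat.GCD using (module Bézout)
open import Data.Nat.Tactic.RingSolver using (solve-∀)
open import Data.Fin using (Fin; toℕ; zero; suc; fromℕ<)
open import Data.Fin.Properties using (toℕ-injective; toℕ<n; toℕ-fromℕ<)
open import Data.Fin.Permutation using (Permutation′; permutation)
open import Data.Vec using (Vec; []; _∷_; lookup; replicate; zipWith; head; tail; allFin; toList)
open import Data.Vec.Properties
  using (lookup∘tabulate; tabulate∘lookup; tabulate-cong; lookup-replicate; lookup-zipWith)
open import Data.Vec.Membership.Propositional.Properties using (∈-allFin⁺; ∈-toList⁺)
open import Data.List using (List; []; _∷_; map; length; concatMap; _++_)
open import Data.List.Membership.Propositional using (_∈_; lose; find)
open import Data.List.Relation.Unary.Any using (Any; here; there)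
import Data.List.Relation.Unary.All as All
import Data.List.Relation.Unary.All.Properties as All
open import Data.List.Relation.Unary.AllPairs using (AllPairs; []; _∷_)
import Data.List.Relation.Unary.AllPairs.Properties as AllPairs
open import Data.List.Properties using (length-++; length-map; foldr-preservesᵒ; foldr-preservesᵇ)
open import Data.List.Membership.Propositional.Properties
  using (∈-map⁺; ∈-map⁻; ∈-++⁺ˡ; ∈-++⁺ʳ; ∈-++⁻; ∈-concatMap⁺; ∈-concatMap⁻; ∈-filter⁺; ∈-filter⁻;
         ∈-applyUpTo⁺; ∈-applyUpTo⁻; foldr-selective)
open import Data.List.Relation.Unary.Unique.Propositional using (Unique)
open import Data.List.Relation.Binary.Disjoint.Propositional using (Disjoint)
import Data.List.Relation.Unary.Unique.Propositional.Properties as Unique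
open import Relation.Nullary using (¬_; yes; no)
open import Function.Bundles using (_⇔_; mk⇔; Equivalence)
open import Data.Product using (∃-syntax; _×_; _,_; proj₁; proj₂)
open import Data.Empty using (⊥; ⊥-elim)
open import Data.Sum using (inj₁; inj₂; [_,_])
open import Relation.Binary.Core using (Rel)
open import Level using (0ℓ)
open import Relation.Binary.PropositionalEquality hiding ([_])
open import Function using (_∘_)

open import Algebra.Properties.CommutativeMonoid.Sum +-0-commutativeMonoid using (sum; sum-cong-≗; sum-permute)
open import Algebra.Properties.Semiring.Sum +-*-semiring using (*-distribˡ-sum)
open import Algebra.Properties.CommutativeSemigroup +-commutativeSemigroup using () renaming (interchange to +-interchange)

AllPairs-mapWith∈ : ∀ {A : Set} {R S : Rel A 0ℓ} {xs : List A} →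
                    (∀ {x y} → x ∈ xs → y ∈ xs → R x y → S x y) → AllPairs R xs → AllPairs S xs
AllPairs-mapWith∈ f [] = []
AllPairs-mapWith∈ f (Rx ∷ Rxs) =
  All.tabulate (λ y∈ → f (here refl) (there y∈) (All.lookup Rx y∈))
  ∷ AllPairs-mapWith∈ (λ x∈ y∈ → f (there x∈) (there y∈)) Rxs

length-concatMap-const : ∀ {A B : Set} (f : A → List B) {c} → (∀ x → length (f x) ≡ c) →
                         ∀ xs → length (concatMap f xs) ≡ c * length xs
length-concatMap-const f {c} _     []       = sym (*-zeroʳ c)
length-concatMap-const f {c} len-f (x ∷ xs) = begin
  length (f x ++ concatMap f xs)          ≡⟨ length-++ (f x) ⟩
  length (f x) + length (concatMap f xs)  ≡⟨ cong₂ _+_ (len-f x) (length-concatMap-const f len-f xs) ⟩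
  c + c * length xs                       ≡⟨ *-suc c (length xs) ⟨
  c * suc (length xs)                     ∎
  where open ≡-Reasoning

[m%d*n]%d≡[m*n]%d : ∀ m n d .{{_ : NonZero d}} → ((m % d) * n) % d ≡ (m * n) % d
[m%d*n]%d≡[m*n]%d m n d = begin
  ((m % d) * n) % d             ≡⟨ %-distribˡ-* (m % d) n d ⟩
  ((m % d % d) * (n % d)) % d   ≡⟨ cong (λ x → (x * (n % d)) % d) (m%n%n≡m%n m d) ⟩
  ((m % d) * (n % d)) % d       ≡⟨ %-distribˡ-* m n d ⟨
  (m * n) % d                   ∎
  where open ≡-Reasoning

[m*[n%d]]%d≡[m*n]%d : ∀ m n d .{{_ : NonZero d}} → (m * (n % d)) % d ≡ (m * n) % d
[m*[n%d]]%d≡[m*n]%d m n d = begin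
  (m * (n % d)) % d   ≡⟨ cong (_% d) (*-comm m (n % d)) ⟩
  ((n % d) * m) % d   ≡⟨ [m%d*n]%d≡[m*n]%d n m d ⟩
  (n * m) % d         ≡⟨ cong (_% d) (*-comm n m) ⟩
  (m * n) % d         ∎
  where open ≡-Reasoning

%≡1⇒< : ∀ {a} m .{{_ : NonZero m}} → a % m ≡ 1 → 1 < a → m < a
%≡1⇒< {a} m a%m≡1 1<a with a / m | m≡m%n+[m/n]*n a m
... | zero  | a≡ = ⊥-elim (<-irrefl (sym (trans a≡ (cong (_+ 0) a%m≡1))) 1<a)
... | suc q | a≡ = begin-strict
  m                 <⟨ s≤s (m≤m+n m (q * m)) ⟩
  1 + (m + q * m)   ≡⟨ cong (_+ (m + q * m)) a%m≡1 ⟨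
  a % m + suc q * m ≡⟨ a≡ ⟨
  a                 ∎
  where open ≤-Reasoning

sum-cong-% : ∀ {L} m .{{_ : NonZero m}} (f g : Fin L → ℕ) →
             (∀ i → f i % m ≡ g i % m) → sum f % m ≡ sum g % m
sum-cong-% {zero}  m f g f≈g = refl
sum-cong-% {suc L} m f g f≈g = begin
  (f zero + sum (f ∘ suc)) % m
    ≡⟨ %-distribˡ-+ (f zero) _ m ⟩
  (f zero % m + sum (f ∘ suc) % m) % m
    ≡⟨ cong₂ (λ x y → (x + y) % m) (f≈g zero) (sum-cong-% m (f ∘ suc) (g ∘ suc) (f≈g ∘ suc)) ⟩
  (g zero % m + sum (g ∘ suc) % m) % m
    ≡⟨ %-distribˡ-+ (g zero) _ m ⟨
  (g zero + sum (g ∘ suc)) % m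
    ∎
  where open ≡-Reasoning

-- Weight and degree of vectors

entry : ∀ {L} → Vec ℕ L → ℕ → ℕ
entry []      _       = 0
entry (x ∷ v) zero    = x
entry (x ∷ v) (suc i) = entry v i

lookup≡entry : ∀ {L} (v : Vec ℕ L) i → lookup v i ≡ entry v (toℕ i)
lookup≡entry (x ∷ v) zero    = refl
lookup≡entry (x ∷ v) (suc i) = lookup≡entry v i

lookup≤deg : ∀ {L} (v : Vec ℕ L) i → lookup v i ≤ deg v
lookup≤deg (x ∷ v) zero    = m≤m+n x (deg v)
lookup≤deg (x ∷ v) (suc i) = ≤-trans (lookup≤deg v i) (m≤n+m (deg v) x)

lookup+lookup≤deg : ∀ {L} (v : Vec ℕ L) {i j} → i ≢ j → lookup v i + lookup v j ≤ deg v
lookup+lookup≤deg (x ∷ v) {zero}  {zero}  i≢j = ⊥-elim (i≢j refl)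
lookup+lookup≤deg (x ∷ v) {zero}  {suc j} _   = +-monoʳ-≤ x (lookup≤deg v j)
lookup+lookup≤deg (x ∷ v) {suc i} {zero}  _   = subst (_≤ x + deg v) (+-comm x _) (+-monoʳ-≤ x (lookup≤deg v i))
lookup+lookup≤deg (x ∷ v) {suc i} {suc j} i≢j =
  ≤-trans (lookup+lookup≤deg v (i≢j ∘ cong suc)) (m≤n+m (deg v) x)

deg≡sum : ∀ {L} (v : Vec ℕ L) → deg v ≡ sum (lookup v)
deg≡sum []      = refl
deg≡sum (x ∷ v) = cong (x +_) (deg≡sum v)

weightFrom≡sum : ∀ {L} c (v : Vec ℕ L) → weightFrom c v ≡ sum (λ i → (c + toℕ i) * lookup v i)
weightFrom≡sum c []      = refl
weightFrom≡sum c (x ∷ v) = cong₂ _+_ (cong (_* x) (sym (+-identityʳ c)))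
  (trans (weightFrom≡sum (suc c) v) (sum-cong-≗ (λ i → cong (_* lookup v i) (sym (+-suc c (toℕ i))))))

weightFrom-+ : ∀ {L} c d (v : Vec ℕ L) → weightFrom (c + d) v ≡ c * deg v + weightFrom d v
weightFrom-+ c d []      = sym (trans (+-identityʳ (c * 0)) (*-zeroʳ c))
weightFrom-+ c d (x ∷ v) = begin
  (c + d) * x + weightFrom (suc (c + d)) v           ≡⟨ cong (λ e → (c + d) * x + weightFrom e v) (+-suc c d) ⟨
  (c + d) * x + weightFrom (c + suc d) v             ≡⟨ cong ((c + d) * x +_) (weightFrom-+ c (suc d) v) ⟩
  (c + d) * x + (c * deg v + weightFrom (suc d) v)   ≡⟨ regroup c d x (deg v) (weightFrom (suc d) v) ⟩
  c * (x + deg v) + (d * x + weightFrom (suc d) v)   ∎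
  where
    open ≡-Reasoning
    regroup : ∀ c d x D W → (c + d) * x + (c * D + W) ≡ c * (x + D) + (d * x + W)
    regroup = solve-∀

deg≤weight : ∀ {L} (v : Vec ℕ L) → deg v ≤ weight v
deg≤weight v = begin
  deg v                       ≤⟨ m≤m+n (deg v) (weightFrom 0 v) ⟩
  deg v + weightFrom 0 v      ≡⟨ cong (_+ weightFrom 0 v) (*-identityˡ (deg v)) ⟨
  1 * deg v + weightFrom 0 v  ≡⟨ weightFrom-+ 1 0 v ⟨
  weight v                    ∎
  where open ≤-Reasoning

weight-∷ : ∀ {L} x (v : Vec ℕ L) → weight (x ∷ v) ≡ x + (deg v + weight v)
weight-∷ x v = cong₂ _+_ (*-identityˡ x) (trans (weightFrom-+ 1 1 v) (cong (_+ weight v) (*-identityˡ (deg v))))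

weightFrom-zipWith : ∀ {L} c (u v : Vec ℕ L) → weightFrom c (zipWith _+_ u v) ≡ weightFrom c u + weightFrom c v
weightFrom-zipWith c []      []      = refl
weightFrom-zipWith c (x ∷ u) (y ∷ v) = begin
  c * (x + y) + weightFrom (suc c) (zipWith _+_ u v)
    ≡⟨ cong₂ _+_ (*-distribˡ-+ c x y) (weightFrom-zipWith (suc c) u v) ⟩
  (c * x + c * y) + (weightFrom (suc c) u + weightFrom (suc c) v)
    ≡⟨ +-interchange (c * x) (c * y) (weightFrom (suc c) u) (weightFrom (suc c) v) ⟩
  (c * x + weightFrom (suc c) u) + (c * y + weightFrom (suc c) v) ∎
  where open ≡-Reasoning

weightFrom-zeros : ∀ {L} c → weightFrom c (replicate L 0) ≡ 0
weightFrom-zeros {zero}  c = refl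
weightFrom-zeros {suc L} c = cong₂ _+_ (*-zeroʳ c) (weightFrom-zeros {L} (suc c))

weightFrom≡0⇒zeros : ∀ {L} c (v : Vec ℕ L) → weightFrom (suc c) v ≡ 0 → v ≡ replicate L 0
weightFrom≡0⇒zeros c []          _   = refl
weightFrom≡0⇒zeros c (zero ∷ v)  w≡0 =
  cong (0 ∷_) (weightFrom≡0⇒zeros (suc c) v (trans (cong (_+ weightFrom (suc (suc c)) v) (sym (*-zeroʳ (suc c)))) w≡0))

weight-pos : ∀ {L} (v : Vec ℕ L) → v ≢ replicate L 0 → 0 < weight v
weight-pos v v≢0 with weight v in w≡
... | zero  = ⊥-elim (v≢0 (weightFrom≡0⇒zeros 0 v w≡))
... | suc _ = s≤s z≤n

entry-weightFrom : ∀ {L} c (v : Vec ℕ L) i → (c + i) * entry v i ≤ weightFrom c v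
entry-weightFrom c []      i       = ≤-reflexive (*-zeroʳ (c + i))
entry-weightFrom c (x ∷ v) zero    = ≤-trans (≤-reflexive (cong (_* x) (+-identityʳ c))) (m≤m+n (c * x) _)
entry-weightFrom c (x ∷ v) (suc i) = ≤-trans (≤-reflexive (cong (_* entry v i) (+-suc c i)))
                                       (≤-trans (entry-weightFrom (suc c) v i) (m≤n+m _ (c * x)))

-- weight v + v₀ - 2 deg v = Σ_{i ≥ 1} (toℕ i - 1) vᵢ, a sum of non-negative terms.
deg+deg+[i∸1]*vᵢ≤weight+v₀ : ∀ {L} (v : Vec ℕ (suc L)) i →
                              deg v + deg v + (toℕ i ∸ 1) * lookup v i ≤ weight v + lookup v zero
deg+deg+[i∸1]*vᵢ≤weight+v₀ (x ∷ r) i = begin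
  (x + deg r) + (x + deg r) + (toℕ i ∸ 1) * lookup (x ∷ r) i ≤⟨ +-monoʳ-≤ ((x + deg r) + (x + deg r)) (bound i) ⟩
  (x + deg r) + (x + deg r) + weightFrom 0 r                 ≡⟨ regroup x (deg r) (weightFrom 0 r) ⟩
  1 * x + (2 * deg r + weightFrom 0 r) + x                   ≡⟨ cong (λ w → 1 * x + w + x) (weightFrom-+ 2 0 r) ⟨
  1 * x + weightFrom 2 r + x                                 ∎
  where
    open ≤-Reasoning
    regroup : ∀ x D W → (x + D) + (x + D) + W ≡ 1 * x + (2 * D + W) + x
    regroup = solve-∀
    bound : ∀ i → (toℕ i ∸ 1) * lookup (x ∷ r) i ≤ weightFrom 0 r
    bound zero    = z≤n
    bound (suc j) = subst (λ e → toℕ j * e ≤ weightFrom 0 r) (sym (lookup≡entry r j)) (entry-weightFrom 0 r (toℕ j))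

-- Partitions as vectors of multiplicities

incAt : ∀ {L} → ℕ → Vec ℕ L → Vec ℕ L
incAt _       []      = []
incAt zero    (x ∷ v) = suc x ∷ v
incAt (suc j) (x ∷ v) = x ∷ incAt j v

decAt : ∀ {L} → ℕ → Vec ℕ L → Vec ℕ L
decAt _       []      = []
decAt zero    (x ∷ v) = x ∸ 1 ∷ v
decAt (suc j) (x ∷ v) = x ∷ decAt j v

-- A vector v with weight v ≡ t encodes the partition of t having entry v i parts equal to i + 1.
PartsAtMost : ∀ {L} → ℕ → Vec ℕ L → Set
PartsAtMost m v = ∀ i → m ≤ i → entry v i ≡ 0

PartsAtMost-mono : ∀ {L} {a b} (v : Vec ℕ L) → a ≤ b → PartsAtMost a v → PartsAtMost b v
PartsAtMost-mono v a≤b p i b≤i = p i (≤-trans a≤b b≤i)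

PartsAtMost-weight : ∀ {L} (v : Vec ℕ L) → PartsAtMost (weight v) v
PartsAtMost-weight v i w≤i with entry v i in e
... | zero  = refl
... | suc x = ⊥-elim (<-irrefl refl (begin-strict
  weight v               ≤⟨ w≤i ⟩
  i                      <⟨ m≤m*n (suc i) (suc x) ⟩
  suc i * suc x          ≡⟨ cong (suc i *_) e ⟨
  (1 + i) * entry v i    ≤⟨ entry-weightFrom 1 v i ⟩
  weight v               ∎))
  where open ≤-Reasoning

PartsAtMost-zero : ∀ {L} (v : Vec ℕ L) → PartsAtMost 0 v → v ≡ replicate L 0
PartsAtMost-zero []      _ = refl
PartsAtMost-zero (x ∷ v) p = cong₂ _∷_ (p 0 z≤n) (PartsAtMost-zero v (λ i _ → p (suc i) z≤n))

entry-zeros : ∀ {L} i → entry (replicate L 0) i ≡ 0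
entry-zeros {zero}  i       = refl
entry-zeros {suc L} zero    = refl
entry-zeros {suc L} (suc i) = entry-zeros {L} i

entry-incAt-≡ : ∀ {L} j (v : Vec ℕ L) → j < L → entry (incAt j v) j ≡ suc (entry v j)
entry-incAt-≡ zero    (x ∷ v) _         = refl
entry-incAt-≡ (suc j) (x ∷ v) (s≤s j<L) = entry-incAt-≡ j v j<L

entry-incAt-≢ : ∀ {L} j (v : Vec ℕ L) i → i ≢ j → entry (incAt j v) i ≡ entry v i
entry-incAt-≢ j       []      i       _   = refl
entry-incAt-≢ zero    (x ∷ v) zero    i≢j = ⊥-elim (i≢j refl)
entry-incAt-≢ zero    (x ∷ v) (suc i) _   = refl
entry-incAt-≢ (suc j) (x ∷ v) zero    _   = refl
entry-incAt-≢ (suc j) (x ∷ v) (suc i) i≢j = entry-incAt-≢ j v i (i≢j ∘ cong suc)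

entry-decAt-≢ : ∀ {L} j (v : Vec ℕ L) i → i ≢ j → entry (decAt j v) i ≡ entry v i
entry-decAt-≢ j       []      i       _   = refl
entry-decAt-≢ zero    (x ∷ v) zero    i≢j = ⊥-elim (i≢j refl)
entry-decAt-≢ zero    (x ∷ v) (suc i) _   = refl
entry-decAt-≢ (suc j) (x ∷ v) zero    _   = refl
entry-decAt-≢ (suc j) (x ∷ v) (suc i) i≢j = entry-decAt-≢ j v i (i≢j ∘ cong suc)

incAt-decAt : ∀ {L} j (v : Vec ℕ L) → 0 < entry v j → incAt j (decAt j v) ≡ v
incAt-decAt j       []          _   = refl
incAt-decAt zero    (suc x ∷ v) _   = refl
incAt-decAt (suc j) (x ∷ v)     pos = cong (x ∷_) (incAt-decAt j v pos)

incAt-injective : ∀ {L} j {u v : Vec ℕ L} → incAt j u ≡ incAt j v → u ≡ v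
incAt-injective j       {[]}    {[]}    _  = refl
incAt-injective zero    {x ∷ u} {y ∷ v} eq = cong₂ _∷_ (suc-injective (cong head eq)) (cong tail eq)
incAt-injective (suc j) {x ∷ u} {y ∷ v} eq = cong₂ _∷_ (cong head eq) (incAt-injective j (cong tail eq))

weightFrom-incAt : ∀ {L} c j (v : Vec ℕ L) → j < L → weightFrom c (incAt j v) ≡ weightFrom c v + (c + j)
weightFrom-incAt c zero    (x ∷ v) _         = shift c x (weightFrom (suc c) v)
  where
    shift : ∀ c x W → c * suc x + W ≡ (c * x + W) + (c + 0)
    shift = solve-∀
weightFrom-incAt c (suc j) (x ∷ v) (s≤s j<L) =
  trans (cong (c * x +_) (weightFrom-incAt (suc c) j v j<L)) (shift c x (weightFrom (suc c) v) j)
  where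
    shift : ∀ c x W j → c * x + (W + (suc c + j)) ≡ (c * x + W) + (c + suc j)
    shift = solve-∀

largestPart : ∀ {L} m (v : Vec ℕ L) → PartsAtMost m v → v ≢ replicate L 0 →
              ∃[ j ] (j < m × 0 < entry v j × PartsAtMost (suc j) v)
largestPart zero    v p v≢0 = ⊥-elim (v≢0 (PartsAtMost-zero v p))
largestPart (suc m) v p v≢0 with entry v m in e
... | suc _ = m , ≤-refl , subst (0 <_) (sym e) (s≤s z≤n) , p
... | zero  = let j , j<m , pos , pj = largestPart m v p′ v≢0 in j , m<n⇒m<1+n j<m , pos , pj
  where
    p′ : PartsAtMost m v
    p′ i m≤i with m≤n⇒m<n∨m≡n m≤i
    ... | inj₁ m<i  = p i m<i
    ... | inj₂ refl = e

module _ {L : ℕ} where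

  -- The recursion, on the largest part j + 1, mirrors that of `parts` in Defs.
  mutual
    partitionsAtMost : (fuel t m : ℕ) → List (Vec ℕ L)
    partitionsAtMost _       zero    _ = replicate L 0 ∷ []
    partitionsAtMost zero    (suc t) _ = []
    partitionsAtMost (suc f) (suc t) m = byLargestPart f (suc t) (suc t ⊓ m)

    byLargestPart : (fuel t j : ℕ) → List (Vec ℕ L)
    byLargestPart f t zero    = []
    byLargestPart f t (suc j) = map (incAt j) (partitionsAtMost f (t ∸ suc j) (suc j)) ++ byLargestPart f t j

  mutual
    length-partitionsAtMost : ∀ f t m → length (partitionsAtMost f t m) ≡ parts f t m
    length-partitionsAtMost f       zero    m = refl
    length-partitionsAtMost zero    (suc t) m = refl
    length-partitionsAtMost (suc f) (suc t) m = length-byLargestPart f (suc t) (suc t ⊓ m)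

    length-byLargestPart : ∀ f t j → length (byLargestPart f t j) ≡ sumTo j (λ j → parts f (t ∸ j) j)
    length-byLargestPart f t zero    = refl
    length-byLargestPart f t (suc j) = begin
      length (map (incAt j) new ++ byLargestPart f t j)
        ≡⟨ length-++ (map (incAt j) new) ⟩
      length (map (incAt j) new) + length (byLargestPart f t j)
        ≡⟨ cong₂ _+_ (length-map (incAt j) new) (length-byLargestPart f t j) ⟩
      length new + sumTo j (λ j → parts f (t ∸ j) j)
        ≡⟨ cong (_+ _) (length-partitionsAtMost f (t ∸ suc j) (suc j)) ⟩
      sumTo (suc j) (λ j → parts f (t ∸ j) j)
        ∎
      where
        open ≡-Reasoning
        new = partitionsAtMost f (t ∸ suc j) (suc j)

  incAt-partition : ∀ {t} j (v : Vec ℕ L) → j < L → suc j ≤ t → weight v ≡ t ∸ suc j → PartsAtMost (suc j) v →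
                    weight (incAt j v) ≡ t × PartsAtMost (suc j) (incAt j v)
  incAt-partition {t} j v j<L j<t w p =
    trans (weightFrom-incAt 1 j v j<L) (trans (cong (_+ suc j) w) (m∸n+n≡m j<t)) ,
    λ i j<i → trans (entry-incAt-≢ j v i (λ { refl → <-irrefl refl j<i })) (p i j<i)

  mutual
    partitionsAtMost-sound : ∀ f t m → m ≤ L → ∀ {v} → v ∈ partitionsAtMost f t m → weight v ≡ t × PartsAtMost m v
    partitionsAtMost-sound f       zero    m _   (here refl) = weightFrom-zeros {L} 1 , λ i _ → entry-zeros {L} i
    partitionsAtMost-sound (suc f) (suc t) m m≤L {v} v∈      =
      let w , p = byLargestPart-sound f (suc t) (suc t ⊓ m) (m⊓n≤m (suc t) m) (≤-trans (m⊓n≤n (suc t) m) m≤L) v∈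
      in w , PartsAtMost-mono v (m⊓n≤n (suc t) m) p

    byLargestPart-sound : ∀ f t j → j ≤ t → j ≤ L → ∀ {v} → v ∈ byLargestPart f t j →
                          weight v ≡ t × PartsAtMost j v
    byLargestPart-sound f t (suc j) j<t j<L {v} v∈ with ∈-++⁻ (map (incAt j) (partitionsAtMost f (t ∸ suc j) (suc j))) v∈
    ... | inj₂ v∈rest =
      let w , p = byLargestPart-sound f t j (≤-trans (n≤1+n j) j<t) (≤-trans (n≤1+n j) j<L) v∈rest
      in w , PartsAtMost-mono v (n≤1+n j) p
    ... | inj₁ v∈new with ∈-map⁻ (incAt j) v∈new
    ...   | u , u∈ , refl =
      let w , p = partitionsAtMost-sound f (t ∸ suc j) (suc j) j<L u∈ in incAt-partition j u j<L j<t w p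

  mutual
    partitionsAtMost-unique : ∀ f t m → m ≤ L → Unique (partitionsAtMost f t m)
    partitionsAtMost-unique f       zero    m _   = All.[] ∷ []
    partitionsAtMost-unique zero    (suc t) m _   = []
    partitionsAtMost-unique (suc f) (suc t) m m≤L =
      byLargestPart-unique f (suc t) (suc t ⊓ m) (m⊓n≤m (suc t) m) (≤-trans (m⊓n≤n (suc t) m) m≤L)

    byLargestPart-unique : ∀ f t j → j ≤ t → j ≤ L → Unique (byLargestPart f t j)
    byLargestPart-unique f t zero    _   _   = []
    byLargestPart-unique f t (suc j) j<t j<L =
      Unique.++⁺ (Unique.map⁺ (incAt-injective j) (partitionsAtMost-unique f (t ∸ suc j) (suc j) j<L))
                 (byLargestPart-unique f t j j≤t j≤L) disjoint
      where
        j≤t = ≤-trans (n≤1+n j) j<t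
        j≤L = ≤-trans (n≤1+n j) j<L
        disjoint : ∀ {v} → ¬ (v ∈ map (incAt j) (partitionsAtMost f (t ∸ suc j) (suc j)) × v ∈ byLargestPart f t j)
        disjoint (v∈new , v∈rest) with ∈-map⁻ (incAt j) v∈new
        ... | u , _ , refl = 0≢1+n (trans (sym (proj₂ (byLargestPart-sound f t j j≤t j≤L v∈rest) j ≤-refl))
                                          (entry-incAt-≡ j u j<L))

  ∈byLargestPart : ∀ f t j J → j < J → ∀ {v} → v ∈ map (incAt j) (partitionsAtMost f (t ∸ suc j) (suc j)) →
                   v ∈ byLargestPart f t J
  ∈byLargestPart f t j (suc J) j<1+J v∈ with j ≟ J
  ... | yes refl = ∈-++⁺ˡ v∈
  ... | no  j≢J  = ∈-++⁺ʳ (map (incAt J) _) (∈byLargestPart f t j J (≤∧≢⇒< (s≤s⁻¹ j<1+J) j≢J) v∈)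

  partitionsAtMost-complete : ∀ f t m → t ≤ f → m ≤ L → ∀ v → weight v ≡ t → PartsAtMost m v →
                              v ∈ partitionsAtMost f t m
  partitionsAtMost-complete f       zero    m _         _   v w _ = here (weightFrom≡0⇒zeros 0 v w)
  partitionsAtMost-complete (suc f) (suc t) m (s≤s t≤f) m≤L v w p
    with largestPart m v p (λ v≡0 → 0≢1+n (trans (sym (weightFrom-zeros {L} 1)) (trans (cong weight (sym v≡0)) w)))
  ... | j , j<m , pos , pj = ∈byLargestPart f (suc t) j (suc t ⊓ m) (⊓-glb j<1+t j<m)
    (subst (_∈ map (incAt j) (partitionsAtMost f (suc t ∸ suc j) (suc j))) (incAt-decAt j v pos) (∈-map⁺ (incAt j) u∈))
    where
      j<L = ≤-trans j<m m≤L
      j<1+t : suc j ≤ suc t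
      j<1+t = begin
        suc j                ≤⟨ m≤m*n (suc j) (entry v j) {{>-nonZero pos}} ⟩
        (1 + j) * entry v j  ≤⟨ entry-weightFrom 1 v j ⟩
        weight v             ≡⟨ w ⟩
        suc t                ∎
        where open ≤-Reasoning
      u = decAt j v
      u-weight : weight u ≡ suc t ∸ suc j
      u-weight = begin
        weight u                           ≡⟨ m+n∸n≡m (weight u) (suc j) ⟨
        weight u + (1 + j) ∸ suc j         ≡⟨ cong (_∸ suc j) (weightFrom-incAt 1 j u j<L) ⟨
        weight (incAt j u) ∸ suc j         ≡⟨ cong (λ x → weight x ∸ suc j) (incAt-decAt j v pos) ⟩
        weight v ∸ suc j                   ≡⟨ cong (_∸ suc j) w ⟩
        suc t ∸ suc j                      ∎
        where open ≡-Reasoning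
      u-parts : PartsAtMost (suc j) u
      u-parts i j<i = trans (entry-decAt-≢ j v i (λ { refl → <-irrefl refl j<i })) (pj i j<i)
      u∈ : u ∈ partitionsAtMost f (suc t ∸ suc j) (suc j)
      u∈ = partitionsAtMost-complete f (suc t ∸ suc j) (suc j) (≤-trans (m∸n≤m t j) t≤f) j<L u u-weight u-parts

partitionsOf : ∀ {L} → ℕ → List (Vec ℕ L)
partitionsOf t = partitionsAtMost t t t

length-partitionsOf : ∀ {L} t → length (partitionsOf {L} t) ≡ p t
length-partitionsOf t = length-partitionsAtMost t t t

partitionsOf-unique : ∀ {L t} → t ≤ L → Unique (partitionsOf {L} t)
partitionsOf-unique {t = t} = partitionsAtMost-unique t t t

∈partitionsOf⇔ : ∀ {L t} → t ≤ L → ∀ v → v ∈ partitionsOf {L} t ⇔ weight v ≡ t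
∈partitionsOf⇔ {t = t} t≤L v = mk⇔
  (proj₁ ∘ partitionsAtMost-sound t t t t≤L)
  (λ w → partitionsAtMost-complete t t t ≤-refl t≤L v w (subst (λ m → PartsAtMost m v) w (PartsAtMost-weight v)))

-- Arithmetic of rigidity

m+m≤n+n⇒m≤n : ∀ {m n} → m + m ≤ n + n → m ≤ n
m+m≤n+n⇒m≤n {m} {n} m+m≤n+n = ≮⇒≥ (λ n<m → <⇒≱ (+-mono-< n<m n<m) m+m≤n+n)

excess⇒gap : ∀ {n k a b} t → n + 2 ≤ k + k → k + k + suc t * b ≤ n + a → 2 + b ≤ a
excess⇒gap {n} {k} {a} {b} t n+2≤2k excess = +-cancelˡ-≤ n (2 + b) a (begin
  n + (2 + b)          ≡⟨ +-assoc n 2 b ⟨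
  n + 2 + b            ≤⟨ +-mono-≤ n+2≤2k (m≤m+n b (t * b)) ⟩
  k + k + suc t * b    ≤⟨ excess ⟩
  n + a                ∎)
  where open ≤-Reasoning

rigidity-arith-u≡2 : ∀ {n k a b} t → n < 2 * (2 + t) → n + 2 ≤ k + k →
                    k + k + t * b ≤ n + a → k + k + 0 ≤ n + b → a + b ≤ k → ⊥
rigidity-arith-u≡2 {n} {k} {a} {b} t n<2[2+t] n+2≤2k excessᵥ excessᵤ a+b≤k = <-irrefl refl (begin-strict
  2 + suc t * 2        ≤⟨ +-mono-≤ 2≤k (*-monoʳ-≤ (suc t) 2≤b) ⟩
  k + suc t * b        ≤⟨ k+[1+t]b≤n ⟩
  n                    <⟨ n<2[2+t] ⟩
  2 * (2 + t)          ≡⟨ regroup t ⟩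
  2 + suc t * 2        ∎)
  where
    open ≤-Reasoning
    regroup : ∀ t → 2 * (2 + t) ≡ 2 + suc t * 2
    regroup = solve-∀
    2≤b : 2 ≤ b
    2≤b = +-cancelˡ-≤ n 2 b (≤-trans n+2≤2k (≤-trans (m≤m+n (k + k) 0) excessᵤ))
    2≤k : 2 ≤ k
    2≤k = ≤-trans 2≤b (≤-trans (m≤n+m b a) a+b≤k)
    k+[1+t]b≤n : k + suc t * b ≤ n
    k+[1+t]b≤n = +-cancelˡ-≤ k (k + suc t * b) n (begin
      k + (k + suc t * b)   ≡⟨ regroup′ k t b ⟩
      (k + k + t * b) + b   ≤⟨ +-monoˡ-≤ b excessᵥ ⟩
      (n + a) + b           ≡⟨ +-assoc n a b ⟩
      n + (a + b)           ≤⟨ +-monoʳ-≤ n a+b≤k ⟩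
      n + k                 ≡⟨ +-comm n k ⟩
      k + n                 ∎)
      where
        regroup′ : ∀ k t b → k + (k + suc t * b) ≡ (k + k + t * b) + b
        regroup′ = solve-∀

-- The arithmetic core of rigidity: a = a₁ and b = a_v for u * v ≡ 1 (mod n).
rigidity-arith : ∀ {n k a b u v} → 2 ≤ u → 2 ≤ v → n < u * v → n + 2 ≤ k + k →
                 k + k + (v ∸ 2) * b ≤ n + a → k + k + (u ∸ 2) * a ≤ n + b → a + b ≤ k → ⊥
rigidity-arith {n} {k} {a} {b} {2} {suc (suc t)} (s≤s (s≤s _)) (s≤s (s≤s _)) n<uv n+2≤2k excessᵥ excessᵤ a+b≤k =
  rigidity-arith-u≡2 {n} {k} {a} {b} t n<uv n+2≤2k excessᵥ excessᵤ a+b≤k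
rigidity-arith {n} {k} {a} {b} {suc (suc (suc s))} {2} (s≤s (s≤s _)) (s≤s (s≤s _)) n<uv n+2≤2k excessᵥ excessᵤ a+b≤k =
  rigidity-arith-u≡2 {n} {k} {b} {a} (suc s) (subst (n <_) (*-comm (3 + s) 2) n<uv) n+2≤2k excessᵤ excessᵥ
    (subst (_≤ k) (+-comm a b) a+b≤k)
rigidity-arith {n} {k} {a} {b} {suc (suc (suc s))} {suc (suc (suc t))} (s≤s (s≤s _)) (s≤s (s≤s _))
               _ n+2≤2k excessᵥ excessᵤ _ =
  <-irrefl refl (begin-strict
    a             <⟨ m<n+m a (s≤s z≤n) ⟩
    2 + a         ≤⟨ excess⇒gap {n} {k} s n+2≤2k excessᵤ ⟩
    b             <⟨ m<n+m b (s≤s z≤n) ⟩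
    2 + b         ≤⟨ excess⇒gap {n} {k} t n+2≤2k excessᵥ ⟩
    a             ∎)
  where open ≤-Reasoning

-- Units modulo n and the action of G

findFirst-satisfies : ∀ {L} (d : Fin L) (f : Fin L → ℕ) t is → Any (λ i → f i ≡ t) is → f (findFirst d f t is) ≡ t
findFirst-satisfies d f t (i ∷ is) any with f i ≟ t
... | yes fi≡t = fi≡t
findFirst-satisfies d f t (i ∷ is) (here fi≡t) | no fi≢t = ⊥-elim (fi≢t fi≡t)
findFirst-satisfies d f t (i ∷ is) (there any) | no _    = findFirst-satisfies d f t is any

%≡1⇒coprime : ∀ {g} h m .{{_ : NonZero m}} → (g * h) % m ≡ 1 → Coprime g m
%≡1⇒coprime {g} h m gh≡1 {d} (d∣g , d∣m) = ∣1⇒≡1 (∣m+n∣m⇒∣n d∣qm+1 (∣-trans d∣m (n∣m*n q)))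
  where
    q = (g * h) / m
    d∣qm+1 : d ∣ q * m + 1
    d∣qm+1 = subst (d ∣_) (trans (m≡m%n+[m/n]*n (g * h) m) (trans (cong (_+ q * m) gh≡1) (+-comm 1 (q * m))))
                   (∣-trans d∣g (m∣m*n h))

module _ (n₀ : ℕ) where

  private
    n : ℕ
    n = 2 + n₀

  U : List ℕ
  U = units n

  ∈U⁻ : ∀ {g} → g ∈ U → 0 < g × g < n × Coprime g n
  ∈U⁻ g∈U with ∈-filter⁻ (λ x → coprime? x n) g∈U
  ... | g∈range , cop with ∈-applyUpTo⁻ suc g∈range
  ...   | _ , i<n-1 , refl = s≤s z≤n , s≤s i<n-1 , cop

  ∈U⇒0< : ∀ {g} → g ∈ U → 0 < g
  ∈U⇒0< = proj₁ ∘ ∈U⁻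

  ∈U⇒< : ∀ {g} → g ∈ U → g < n
  ∈U⇒< = proj₁ ∘ proj₂ ∘ ∈U⁻

  ∈U⁺ : ∀ {g} h → g < n → (g * h) % n ≡ 1 → g ∈ U
  ∈U⁺ {zero}  _ _           ()
  ∈U⁺ {suc g} h (s≤s g<n-1) gh≡1 =
    ∈-filter⁺ (λ x → coprime? x n) (∈-applyUpTo⁺ suc g<n-1) (%≡1⇒coprime h n gh≡1)

  1∈U : 1 ∈ U
  1∈U = ∈U⁺ 1 (s≤s (s≤s z≤n)) refl

  units-unique : Unique U
  units-unique = Unique.filter⁺ (λ x → coprime? x n)
    (Unique.applyUpTo⁺₁ suc (suc n₀) (λ i<j _ → <⇒≢ i<j ∘ suc-injective))

  coprime⇒inverse : ∀ {g} → Coprime g n → ∃[ h ] (g * h) % n ≡ 1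
  coprime⇒inverse {g} cop with coprime-Bézout cop
  ... | Bézout.+- x y 1+yn≡xg = x , (begin
    (g * x) % n       ≡⟨ cong (_% n) (trans (*-comm g x) (sym 1+yn≡xg)) ⟩
    (1 + y * n) % n   ≡⟨ [m+kn]%n≡m%n 1 y n ⟩
    1                 ∎)
    where open ≡-Reasoning
  -- Here x * g ≡ -1 (mod n), so (n - 1) * x inverts g.
  ... | Bézout.-+ x y 1+xg≡yn = suc n₀ * x , (begin
    (g * (suc n₀ * x)) % n                   ≡⟨ [m+kn]%n≡m%n (g * (suc n₀ * x)) 1 n ⟨
    (g * (suc n₀ * x) + 1 * n) % n           ≡⟨ cong (_% n) (regroup g (suc n₀) x) ⟩
    (suc n₀ * (1 + x * g) + 1) % n           ≡⟨ cong (λ e → (suc n₀ * e + 1) % n) 1+xg≡yn ⟩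
    (suc n₀ * (y * n) + 1) % n               ≡⟨ cong (_% n) (regroup′ (suc n₀) y) ⟩
    (1 + suc n₀ * y * n) % n                 ≡⟨ [m+kn]%n≡m%n 1 (suc n₀ * y) n ⟩
    1                                        ∎)
    where
      open ≡-Reasoning
      regroup : ∀ g m x → g * (m * x) + 1 * (1 + m) ≡ m * (1 + x * g) + 1
      regroup = solve-∀
      regroup′ : ∀ m y → m * (y * (1 + m)) + 1 ≡ 1 + m * y * (1 + m)
      regroup′ = solve-∀

  *-inverse-cancel : ∀ g h → (g * h) % n ≡ 1 → ∀ x → (g * (h * x)) % n ≡ x % n
  *-inverse-cancel g h gh≡1 x = begin
    (g * (h * x)) % n         ≡⟨ cong (_% n) (*-assoc g h x) ⟨
    ((g * h) * x) % n         ≡⟨ [m%d*n]%d≡[m*n]%d (g * h) x n ⟨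
    (((g * h) % n) * x) % n   ≡⟨ cong (λ e → (e * x) % n) gh≡1 ⟩
    (1 * x) % n               ≡⟨ cong (_% n) (*-identityˡ x) ⟩
    x % n                     ∎
    where open ≡-Reasoning

  inverse : ∀ {g} → g ∈ U → ∃[ h ] (h ∈ U × (g * h) % n ≡ 1 × (h * g) % n ≡ 1)
  inverse {g} g∈U with coprime⇒inverse (proj₂ (proj₂ (∈U⁻ g∈U)))
  ... | h , gh≡1 = h % n , ∈U⁺ g (m%n<n h n) h′g≡1 , trans ([m*[n%d]]%d≡[m*n]%d g h n) gh≡1 , h′g≡1
    where
      h′g≡1 : (h % n * g) % n ≡ 1
      h′g≡1 = trans ([m%d*n]%d≡[m*n]%d h g n) (trans (cong (_% n) (*-comm h g)) gh≡1)

  inv : ∀ {g} → g ∈ U → ℕ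
  inv = proj₁ ∘ inverse

  inv∈U : ∀ {g} (g∈U : g ∈ U) → inv g∈U ∈ U
  inv∈U = proj₁ ∘ proj₂ ∘ inverse

  inverseʳ : ∀ {g} (g∈U : g ∈ U) → (g * inv g∈U) % n ≡ 1
  inverseʳ = proj₁ ∘ proj₂ ∘ proj₂ ∘ inverse

  inverseˡ : ∀ {g} (g∈U : g ∈ U) → (inv g∈U * g) % n ≡ 1
  inverseˡ = proj₂ ∘ proj₂ ∘ proj₂ ∘ inverse

  *-%-∈U : ∀ {g h} → g ∈ U → h ∈ U → (g * h) % n ∈ U
  *-%-∈U {g} {h} g∈U h∈U = ∈U⁺ (inv h∈U * inv g∈U) (m%n<n (g * h) n) (begin
    ((g * h) % n * (h′ * g′)) % n   ≡⟨ [m%d*n]%d≡[m*n]%d (g * h) (h′ * g′) n ⟩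
    ((g * h) * (h′ * g′)) % n       ≡⟨ cong (_% n) (regroup g h h′ g′) ⟩
    (g * (h * (h′ * g′))) % n       ≡⟨ [m*[n%d]]%d≡[m*n]%d g (h * (h′ * g′)) n ⟨
    (g * ((h * (h′ * g′)) % n)) % n ≡⟨ cong (λ e → (g * e) % n) (*-inverse-cancel h h′ (inverseʳ h∈U) g′) ⟩
    (g * (g′ % n)) % n              ≡⟨ [m*[n%d]]%d≡[m*n]%d g g′ n ⟩
    (g * g′) % n                    ≡⟨ inverseʳ g∈U ⟩
    1                               ∎)
    where
      open ≡-Reasoning
      g′ = inv g∈U
      h′ = inv h∈U
      regroup : ∀ g h h′ g′ → (g * h) * (h′ * g′) ≡ g * (h * (h′ * g′))
      regroup = solve-∀

  *-cancelˡ-% : ∀ {g a b} → g ∈ U → a < n → b < n → (g * a) % n ≡ (g * b) % n → a ≡ b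
  *-cancelˡ-% {g} {a} {b} g∈U a<n b<n ga≡gb = begin
    a                              ≡⟨ m<n⇒m%n≡m a<n ⟨
    a % n                          ≡⟨ *-inverse-cancel (inv g∈U) g (inverseˡ g∈U) a ⟨
    (inv g∈U * (g * a)) % n        ≡⟨ [m*[n%d]]%d≡[m*n]%d (inv g∈U) (g * a) n ⟨
    (inv g∈U * ((g * a) % n)) % n  ≡⟨ cong (λ e → (inv g∈U * e) % n) ga≡gb ⟩
    (inv g∈U * ((g * b) % n)) % n  ≡⟨ [m*[n%d]]%d≡[m*n]%d (inv g∈U) (g * b) n ⟩
    (inv g∈U * (g * b)) % n        ≡⟨ *-inverse-cancel (inv g∈U) g (inverseˡ g∈U) b ⟩
    b % n                          ≡⟨ m<n⇒m%n≡m b<n ⟩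
    b                              ∎
    where open ≡-Reasoning

  *-%-pos : ∀ {g x} → g ∈ U → 0 < x → x < n → 0 < (g * x) % n
  *-%-pos {g} {x} g∈U 0<x x<n with (g * x) % n in gx≡0
  ... | suc _ = s≤s z≤n
  ... | zero  = ⊥-elim (<⇒≢ 0<x (sym (*-cancelˡ-% g∈U x<n (s≤s z≤n) (trans gx≡0 (cong (_% n) (sym (*-zeroʳ g)))))))

  val : Fin (suc n₀) → ℕ
  val i = suc (toℕ i)

  val<n : ∀ i → val i < n
  val<n i = s≤s (toℕ<n i)

  val-injective : ∀ {i j} → val i ≡ val j → i ≡ j
  val-injective = toℕ-injective ∘ suc-injective

  index : ∀ {x} → 0 < x → x < n → Fin (suc n₀)
  index {suc x} _ (s≤s x<n-1) = fromℕ< x<n-1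

  val-index : ∀ {x} (0<x : 0 < x) (x<n : x < n) → val (index 0<x x<n) ≡ x
  val-index {suc x} _ (s≤s x<n-1) = cong suc (toℕ-fromℕ< x<n-1)

  σinv-spec : ∀ {g} → g ∈ U → ∀ j → (g * val (σinv n g j)) % n ≡ val j
  σinv-spec {g} g∈U j =
    findFirst-satisfies j (λ i → (g * val i) % n) (val j) (toList (allFin (suc n₀)))
      (lose (∈-toList⁺ (∈-allFin⁺ i)) gi≡j)
    where
      h = inv g∈U
      hj>0 = *-%-pos (inv∈U g∈U) (s≤s z≤n) (val<n j)
      i = index hj>0 (m%n<n (h * val j) n)
      gi≡j : (g * val i) % n ≡ val j
      gi≡j = begin
        (g * val i) % n               ≡⟨ cong (λ x → (g * x) % n) (val-index hj>0 (m%n<n (h * val j) n)) ⟩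
        (g * ((h * val j) % n)) % n   ≡⟨ [m*[n%d]]%d≡[m*n]%d g (h * val j) n ⟩
        (g * (h * val j)) % n         ≡⟨ *-inverse-cancel g h (inverseʳ g∈U) (val j) ⟩
        val j % n                     ≡⟨ m<n⇒m%n≡m (val<n j) ⟩
        val j                         ∎
        where open ≡-Reasoning

  σinv-unique : ∀ {g i j} → g ∈ U → (g * val i) % n ≡ val j → σinv n g j ≡ i
  σinv-unique {j = j} g∈U gi≡j =
    val-injective (*-cancelˡ-% g∈U (val<n _) (val<n _) (trans (σinv-spec g∈U j) (sym gi≡j)))

  σinv-∘ : ∀ {g h} → g ∈ U → h ∈ U → ∀ j → σinv n h (σinv n g j) ≡ σinv n ((g * h) % n) j
  σinv-∘ {g} {h} g∈U h∈U j = sym (σinv-unique (*-%-∈U g∈U h∈U) (begin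
    ((g * h) % n * val x) % n        ≡⟨ [m%d*n]%d≡[m*n]%d (g * h) (val x) n ⟩
    ((g * h) * val x) % n            ≡⟨ cong (_% n) (*-assoc g h (val x)) ⟩
    (g * (h * val x)) % n            ≡⟨ [m*[n%d]]%d≡[m*n]%d g (h * val x) n ⟨
    (g * ((h * val x) % n)) % n      ≡⟨ cong (λ e → (g * e) % n) (σinv-spec h∈U (σinv n g j)) ⟩
    (g * val (σinv n g j)) % n       ≡⟨ σinv-spec g∈U j ⟩
    val j                            ∎))
    where
      open ≡-Reasoning
      x = σinv n h (σinv n g j)

  σinv-1 : ∀ j → σinv n 1 j ≡ j
  σinv-1 j = σinv-unique 1∈U (trans (cong (_% n) (*-identityˡ (val j))) (m<n⇒m%n≡m (val<n j)))

  σinv-inverse : ∀ {g h} → g ∈ U → h ∈ U → (g * h) % n ≡ 1 → ∀ j → σinv n h (σinv n g j) ≡ j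
  σinv-inverse g∈U h∈U gh≡1 j = trans (σinv-∘ g∈U h∈U j) (trans (cong (λ e → σinv n e j) gh≡1) (σinv-1 j))

  σ-permutation : ∀ {g} → g ∈ U → Permutation′ (suc n₀)
  σ-permutation {g} g∈U = permutation (σinv n g) (σinv n (inv g∈U))
    (σinv-inverse (inv∈U g∈U) g∈U (inverseˡ g∈U)) (σinv-inverse g∈U (inv∈U g∈U) (inverseʳ g∈U))

  lookup-act : ∀ g (A : Sol n) j → lookup (act n g A) j ≡ lookup A (σinv n g j)
  lookup-act g A = lookup∘tabulate (λ j → lookup A (σinv n g j))

  lookup-act-image : ∀ {g i j} (A : Sol n) → g ∈ U → (g * val i) % n ≡ val j → lookup (act n g A) j ≡ lookup A i
  lookup-act-image {g} {j = j} A g∈U gi≡j = trans (lookup-act g A j) (cong (lookup A) (σinv-unique g∈U gi≡j))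

  act-∘ : ∀ {g h} → g ∈ U → h ∈ U → ∀ A → act n g (act n h A) ≡ act n ((g * h) % n) A
  act-∘ {g} {h} g∈U h∈U A =
    tabulate-cong (λ j → trans (lookup-act h A (σinv n g j)) (cong (lookup A) (σinv-∘ g∈U h∈U j)))

  act-1 : ∀ A → act n 1 A ≡ A
  act-1 A = trans (tabulate-cong (cong (lookup A) ∘ σinv-1)) (tabulate∘lookup A)

  act-inv : ∀ {g} (g∈U : g ∈ U) A → act n (inv g∈U) (act n g A) ≡ A
  act-inv {g} g∈U A = trans (act-∘ (inv∈U g∈U) g∈U A) (trans (cong (λ e → act n e A) (inverseˡ g∈U)) (act-1 A))

  act-comm : ∀ {g h} → g ∈ U → h ∈ U → ∀ A → act n g (act n h A) ≡ act n h (act n g A)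
  act-comm {g} {h} g∈U h∈U A =
    trans (act-∘ g∈U h∈U A) (trans (cong (λ e → act n (e % n) A) (*-comm g h)) (sym (act-∘ h∈U g∈U A)))

  act-injective : ∀ {g A B} → g ∈ U → act n g A ≡ act n g B → A ≡ B
  act-injective {g} {A} {B} g∈U gA≡gB = trans (sym (act-inv g∈U A)) (trans (cong (act n (inv g∈U)) gA≡gB) (act-inv g∈U B))

  act-zeros : ∀ g → act n g (zeroSol n) ≡ zeroSol n
  act-zeros g = trans (tabulate-cong (λ j → trans (lookup-replicate (σinv n g j) 0) (sym (lookup-replicate j 0))))
                      (tabulate∘lookup (zeroSol n))

  act-addSol : ∀ g A B → act n g (addSol n A B) ≡ addSol n (act n g A) (act n g B)
  act-addSol g A B = trans (tabulate-cong pointwise) (tabulate∘lookup (addSol n (act n g A) (act n g B)))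
    where
      pointwise : ∀ j → lookup (addSol n A B) (σinv n g j) ≡ lookup (addSol n (act n g A) (act n g B)) j
      pointwise j = begin
        lookup (zipWith _+_ A B) (σinv n g j)                 ≡⟨ lookup-zipWith _+_ (σinv n g j) A B ⟩
        lookup A (σinv n g j) + lookup B (σinv n g j)         ≡⟨ cong₂ _+_ (lookup-act g A j) (lookup-act g B j) ⟨
        lookup (act n g A) j + lookup (act n g B) j           ≡⟨ lookup-zipWith _+_ j (act n g A) (act n g B) ⟨
        lookup (zipWith _+_ (act n g A) (act n g B)) j        ∎
        where open ≡-Reasoning

  deg-act : ∀ {g} → g ∈ U → ∀ A → deg (act n g A) ≡ deg A
  deg-act {g} g∈U A = begin
    deg (act n g A)              ≡⟨ deg≡sum (act n g A) ⟩
    sum (lookup (act n g A))     ≡⟨ sum-cong-≗ (lookup-act g A) ⟩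
    sum (lookup A ∘ σinv n g)    ≡⟨ sum-permute (lookup A) (σ-permutation g∈U) ⟨
    sum (lookup A)               ≡⟨ deg≡sum A ⟨
    deg A                        ∎
    where open ≡-Reasoning

  weight-act-% : ∀ {g} → g ∈ U → ∀ A → weight (act n g A) % n ≡ (g * weight A) % n
  weight-act-% {g} g∈U A = begin
    weight (act n g A) % n
      ≡⟨ cong (_% n) (weightFrom≡sum 1 (act n g A)) ⟩
    sum (λ j → val j * lookup (act n g A) j) % n
      ≡⟨ cong (_% n) (sum-cong-≗ (λ j → cong (val j *_) (lookup-act g A j))) ⟩
    sum (λ j → val j * lookup A (σ j)) % n
      ≡⟨ sum-cong-% n (λ j → val j * lookup A (σ j)) (λ j → g * (val (σ j) * lookup A (σ j))) residue ⟩
    sum (λ j → g * (val (σ j) * lookup A (σ j))) % n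
      ≡⟨ cong (_% n) (sum-permute (λ i → g * (val i * lookup A i)) (σ-permutation g∈U)) ⟨
    sum (λ i → g * (val i * lookup A i)) % n
      ≡⟨ cong (_% n) (*-distribˡ-sum g (λ i → val i * lookup A i)) ⟨
    (g * sum (λ i → val i * lookup A i)) % n
      ≡⟨ cong (λ w → (g * w) % n) (weightFrom≡sum 1 A) ⟨
    (g * weight A) % n
      ∎
    where
      open ≡-Reasoning
      σ = σinv n g
      residue : ∀ j → (val j * lookup A (σ j)) % n ≡ (g * (val (σ j) * lookup A (σ j))) % n
      residue j = begin
        (val j * lookup A (σ j)) % n                 ≡⟨ cong (λ v → (v * lookup A (σ j)) % n) (σinv-spec g∈U j) ⟨
        ((g * val (σ j)) % n * lookup A (σ j)) % n   ≡⟨ [m%d*n]%d≡[m*n]%d (g * val (σ j)) (lookup A (σ j)) n ⟩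
        ((g * val (σ j)) * lookup A (σ j)) % n       ≡⟨ cong (_% n) (*-assoc g (val (σ j)) (lookup A (σ j))) ⟩
        (g * (val (σ j) * lookup A (σ j))) % n       ∎

  InM-act : ∀ {g} → g ∈ U → ∀ A → InM n A → InM n (act n g A)
  InM-act {g} g∈U A n∣wA = m%n≡0⇒n∣m (weight (act n g A)) n (begin
    weight (act n g A) % n       ≡⟨ weight-act-% g∈U A ⟩
    (g * weight A) % n           ≡⟨ [m*[n%d]]%d≡[m*n]%d g (weight A) n ⟨
    (g * (weight A % n)) % n     ≡⟨ cong (λ r → (g * r) % n) (n∣m⇒m%n≡0 (weight A) n n∣wA) ⟩
    (g * 0) % n                  ≡⟨ cong (_% n) (*-zeroʳ g) ⟩
    0                            ∎)
    where open ≡-Reasoning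

  act-nonzero : ∀ {g A} → g ∈ U → A ≢ zeroSol n → act n g A ≢ zeroSol n
  act-nonzero {g} {A} g∈U A≢0 gA≡0 =
    A≢0 (trans (sym (act-inv g∈U A)) (trans (cong (act n (inv g∈U)) gA≡0) (act-zeros (inv g∈U))))

  decomposable-act : ∀ {g A} → g ∈ U → Decomposable n A → Decomposable n (act n g A)
  decomposable-act {g} g∈U (B , C , B∈M , C∈M , B≢0 , C≢0 , A≡B+C) =
    act n g B , act n g C , InM-act g∈U B B∈M , InM-act g∈U C C∈M , act-nonzero g∈U B≢0 , act-nonzero g∈U C≢0 ,
    trans (cong (act n g) A≡B+C) (act-addSol g B C)

  indecomposable-act : ∀ {g A} → g ∈ U → Indecomposable n A → Indecomposable n (act n g A)
  indecomposable-act {g} {A} g∈U (A∈M , A≢0 , ¬dec) =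
    InM-act g∈U A A∈M , act-nonzero g∈U A≢0 ,
    λ dec → ¬dec (subst (Decomposable n) (act-inv g∈U A) (decomposable-act (inv∈U g∈U) dec))

  -- Multiplicity and level

  n≤weight : ∀ A → InM n A → A ≢ zeroSol n → n ≤ weight A
  n≤weight A n∣wA A≢0 = ∣⇒≤ {{>-nonZero (weight-pos A A≢0)}} n∣wA

  weight≡n⇒mult≡1 : ∀ A → weight A ≡ n → mult n A ≡ 1
  weight≡n⇒mult≡1 A wA≡n = trans (cong (_/ n) wA≡n) (n/n≡1 n)

  mult≡1⇒weight≡n : ∀ A → InM n A → mult n A ≡ 1 → weight A ≡ n
  mult≡1⇒weight≡n A (divides q wA≡qn) mA≡1 = trans wA≡qn (trans (cong (_* n) q≡1) (*-identityˡ n))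
    where
      q≡1 : q ≡ 1
      q≡1 = trans (sym (m*n/n≡m q n)) (trans (cong (_/ n) (sym wA≡qn)) mA≡1)

  1≤mult : ∀ A → InM n A → A ≢ zeroSol n → 1 ≤ mult n A
  1≤mult A A∈M A≢0 = m≥n⇒m/n>0 (n≤weight A A∈M A≢0)

  weight≡n⇒indecomposable : ∀ A → weight A ≡ n → Indecomposable n A
  weight≡n⇒indecomposable A wA≡n = subst (n ∣_) (sym wA≡n) ∣-refl , A≢0 , ¬dec
    where
      A≢0 : A ≢ zeroSol n
      A≢0 A≡0 = 0≢1+n (trans (sym (weightFrom-zeros {suc n₀} 1)) (trans (cong weight (sym A≡0)) wA≡n))
      ¬dec : ¬ Decomposable n A
      ¬dec (B , C , B∈M , C∈M , B≢0 , C≢0 , A≡B+C) = <-irrefl refl (begin-strict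
        n                     <⟨ m<m+n n (s≤s z≤n) ⟩
        n + n                 ≤⟨ +-mono-≤ (n≤weight B B∈M B≢0) (n≤weight C C∈M C≢0) ⟩
        weight B + weight C   ≡⟨ weightFrom-zipWith 1 B C ⟨
        weight (addSol n B C) ≡⟨ cong weight A≡B+C ⟨
        weight A              ≡⟨ wA≡n ⟩
        n                     ∎)
        where open ≤-Reasoning

  level≤mult-act : ∀ {g} A → g ∈ U → level n A ≤ mult n (act n g A)
  level≤mult-act {g} A g∈U = foldr-preservesᵒ {P = _≤ mult n (act n g A)} {f = _⊓_}
    (λ x y → [ m≤n⇒m⊓o≤n y , m≤n⇒o⊓m≤n x ]) (mult n A) (map (λ h → mult n (act n h A)) U)
    (inj₂ (lose (∈-map⁺ (λ h → mult n (act n h A)) g∈U) ≤-refl))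

  1≤level : ∀ {A} → Indecomposable n A → 1 ≤ level n A
  1≤level {A} indA@(A∈M , A≢0 , _) = foldr-preservesᵇ {P = 1 ≤_} {f = _⊓_} ⊓-glb (1≤mult A A∈M A≢0)
    (All.map⁺ (All.tabulate λ g∈U → let gA∈M , gA≢0 , _ = indecomposable-act g∈U indA in 1≤mult _ gA∈M gA≢0))

  level≡1⇒mult≡1 : ∀ A → level n A ≡ 1 → ∃[ g ] (g ∈ U × mult n (act n g A) ≡ 1)
  level≡1⇒mult≡1 A ℓA≡1 with foldr-selective ⊓-sel (mult n A) (map (λ g → mult n (act n g A)) U)
  ... | inj₁ ℓA≡mA = 1 , 1∈U , trans (cong (mult n) (act-1 A)) (trans (sym ℓA≡mA) ℓA≡1)
  ... | inj₂ ℓA∈   =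
    let g , g∈U , ℓA≡mgA = ∈-map⁻ (λ g → mult n (act n g A)) ℓA∈ in g , g∈U , trans (sym ℓA≡mgA) ℓA≡1

  -- Rigidity and orbits of level one

  record Mult1 (k : ℕ) (B : Sol n) : Set where
    constructor mult1
    field
      weight≡n : weight B ≡ n
      deg≡k    : deg B ≡ k

  inOrbit-refl : ∀ A → InOrbit n A A
  inOrbit-refl A = 1 , 1∈U , sym (act-1 A)

  inOrbit-sym : ∀ A {B} → InOrbit n A B → InOrbit n B A
  inOrbit-sym A (g , g∈U , refl) = inv g∈U , inv∈U g∈U , sym (act-inv g∈U A)

  inOrbit-trans : ∀ A {B C} → InOrbit n A B → InOrbit n B C → InOrbit n A C
  inOrbit-trans A (g , g∈U , refl) (h , h∈U , refl) = (h * g) % n , *-%-∈U h∈U g∈U , act-∘ h∈U g∈U A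

  inOrbit-mult1⇒level1 : ∀ {k B X} → Mult1 k B → InOrbit n B X → IM n k X × level n X ≡ 1
  inOrbit-mult1⇒level1 {B = B} (mult1 wB≡n degB≡k) (g , g∈U , refl) =
    (indX , trans (deg-act g∈U B) degB≡k) ,
    ≤-antisym (≤-trans (level≤mult-act (act n g B) (inv∈U g∈U))
                       (≤-reflexive (trans (cong (mult n) (act-inv g∈U B)) (weight≡n⇒mult≡1 B wB≡n))))
              (1≤level indX)
    where
      indX = indecomposable-act g∈U (weight≡n⇒indecomposable B wB≡n)

  level1⇒inOrbit-mult1 : ∀ {k} A → IM n k A → level n A ≡ 1 → ∃[ B ] (Mult1 k B × InOrbit n B A)
  level1⇒inOrbit-mult1 A ((A∈M , _) , degA≡k) ℓA≡1 =
    let g , g∈U , mgA≡1 = level≡1⇒mult≡1 A ℓA≡1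
    in act n g A , mult1 (mult≡1⇒weight≡n (act n g A) (InM-act g∈U A A∈M) mgA≡1) (trans (deg-act g∈U A) degA≡k) ,
       inv g∈U , inv∈U g∈U , sym (act-inv g∈U A)

  unitIndex : ∀ {g} → g ∈ U → Fin (suc n₀)
  unitIndex g∈U = index (∈U⇒0< g∈U) (∈U⇒< g∈U)

  val-unitIndex : ∀ {g} (g∈U : g ∈ U) → val (unitIndex g∈U) ≡ g
  val-unitIndex g∈U = val-index (∈U⇒0< g∈U) (∈U⇒< g∈U)

  ≢1⇒2≤ : ∀ {g} → g ∈ U → g ≢ 1 → 2 ≤ g
  ≢1⇒2≤ g∈U g≢1 = ≤∧≢⇒< (∈U⇒0< g∈U) (g≢1 ∘ sym)

  inv≢1 : ∀ {u} (u∈U : u ∈ U) → u ≢ 1 → inv u∈U ≢ 1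
  inv≢1 {u} u∈U u≢1 v≡1 = u≢1 (begin
    u                     ≡⟨ m<n⇒m%n≡m (∈U⇒< u∈U) ⟨
    u % n                 ≡⟨ cong (_% n) (*-identityʳ u) ⟨
    (u * 1) % n           ≡⟨ cong (λ x → (u * x) % n) v≡1 ⟨
    (u * inv u∈U) % n     ≡⟨ inverseʳ u∈U ⟩
    1                     ∎)
    where open ≡-Reasoning

  lookup-act-zero : ∀ {u} (u∈U : u ∈ U) B → lookup (act n u B) zero ≡ lookup B (unitIndex (inv∈U u∈U))
  lookup-act-zero {u} u∈U B =
    lookup-act-image B u∈U (trans (cong (λ x → (u * x) % n) (val-unitIndex (inv∈U u∈U))) (inverseʳ u∈U))

  lookup-act-unitIndex : ∀ {u} (u∈U : u ∈ U) B → lookup (act n u B) (unitIndex u∈U) ≡ lookup B zero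
  lookup-act-unitIndex {u} u∈U B = lookup-act-image B u∈U
    (trans (cong (_% n) (*-identityʳ u)) (trans (m<n⇒m%n≡m (∈U⇒< u∈U)) (sym (val-unitIndex u∈U))))

  mult1-excess : ∀ {k V} → Mult1 k V → ∀ i → k + k + (val i ∸ 2) * lookup V i ≤ n + lookup V zero
  mult1-excess {V = V} (mult1 wV≡n degV≡k) i =
    subst₂ (λ d w → d + d + (val i ∸ 2) * lookup V i ≤ w + lookup V zero) degV≡k wV≡n
      (deg+deg+[i∸1]*vᵢ≤weight+v₀ V i)

  rigidity : ∀ {k B u} → n + 2 ≤ k + k → Mult1 k B → u ∈ U → weight (act n u B) ≡ n → u ≡ 1
  rigidity {k} {B} {u} n+2≤2k mB u∈U wuB≡n with u ≟ 1
  ... | yes u≡1 = u≡1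
  ... | no  u≢1 = ⊥-elim (rigidity-arith 2≤u 2≤v n<uv n+2≤2k excessᵥ excessᵤ a+b≤k)
    where
      open ≤-Reasoning
      v = inv u∈U
      v∈U = inv∈U u∈U
      iᵤ = unitIndex u∈U
      iᵥ = unitIndex v∈U
      a = lookup B zero
      b = lookup B iᵥ
      2≤u = ≢1⇒2≤ u∈U u≢1
      2≤v = ≢1⇒2≤ v∈U (inv≢1 u∈U u≢1)
      n<uv : n < u * v
      n<uv = %≡1⇒< n (inverseʳ u∈U) (≤-trans 2≤u (m≤m*n u v {{>-nonZero (∈U⇒0< v∈U)}}))
      excessᵥ : k + k + (v ∸ 2) * b ≤ n + a
      excessᵥ = subst (λ x → k + k + (x ∸ 2) * b ≤ n + a) (val-unitIndex v∈U) (mult1-excess mB iᵥ)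
      excessᵤ : k + k + (u ∸ 2) * a ≤ n + b
      excessᵤ = begin
        k + k + (u ∸ 2) * a
          ≡⟨ cong₂ (λ x y → k + k + (x ∸ 2) * y) (val-unitIndex u∈U) (lookup-act-unitIndex u∈U B) ⟨
        k + k + (val iᵤ ∸ 2) * lookup (act n u B) iᵤ
          ≤⟨ mult1-excess (mult1 wuB≡n (trans (deg-act u∈U B) (Mult1.deg≡k mB))) iᵤ ⟩
        n + lookup (act n u B) zero
          ≡⟨ cong (n +_) (lookup-act-zero u∈U B) ⟩
        n + b
          ∎
      a+b≤k : a + b ≤ k
      a+b≤k = subst (a + b ≤_) (Mult1.deg≡k mB)
        (lookup+lookup≤deg B (λ 0≡iᵥ → inv≢1 u∈U u≢1 (trans (sym (val-unitIndex v∈U)) (cong val (sym 0≡iᵥ)))))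

  mult1-unique : ∀ {k B C} → n + 2 ≤ k + k → Mult1 k B → InOrbit n B C → weight C ≡ n → C ≡ B
  mult1-unique {B = B} n+2≤2k mB (g , g∈U , refl) wC≡n =
    trans (cong (λ h → act n h B) (rigidity n+2≤2k mB g∈U wC≡n)) (act-1 B)

  TrivialStabilizer : Sol n → Set
  TrivialStabilizer A = ∀ {g} → g ∈ U → act n g A ≡ A → g ≡ 1

  mult1-trivialStabilizer : ∀ {k B} → n + 2 ≤ k + k → Mult1 k B → TrivialStabilizer B
  mult1-trivialStabilizer n+2≤2k mB g∈U gB≡B =
    rigidity n+2≤2k mB g∈U (trans (cong weight gB≡B) (Mult1.weight≡n mB))

  trivialStabilizer-inOrbit : ∀ {A B} → TrivialStabilizer A → InOrbit n A B → TrivialStabilizer B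
  trivialStabilizer-inOrbit {A} trivA (h , h∈U , refl) g∈U ghA≡hA =
    trivA g∈U (act-injective h∈U (trans (act-comm h∈U g∈U A) ghA≡hA))

  orbit : Sol n → List (Sol n)
  orbit A = map (λ g → act n g A) U

  ∈orbit⇔ : ∀ A {B} → B ∈ orbit A ⇔ InOrbit n A B
  ∈orbit⇔ A = mk⇔ (∈-map⁻ (λ g → act n g A)) λ { (g , g∈U , refl) → ∈-map⁺ (λ g → act n g A) g∈U }

  length-orbit : ∀ A → length (orbit A) ≡ φ n
  length-orbit A = length-map (λ g → act n g A) U

  orbit-unique : ∀ {A} → TrivialStabilizer A → Unique (orbit A)
  orbit-unique {A} trivA = AllPairs.map⁺ (AllPairs-mapWith∈ separate units-unique)
    where
      separate : ∀ {g h} → g ∈ U → h ∈ U → g ≢ h → act n g A ≢ act n h A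
      separate {g} {h} g∈U h∈U g≢h gA≡hA = g≢h (*-cancelˡ-% (inv∈U h∈U) (∈U⇒< g∈U) (∈U⇒< h∈U) (begin
        (inv h∈U * g) % n   ≡⟨ trivA (*-%-∈U (inv∈U h∈U) g∈U) h⁻¹gA≡A ⟩
        1                   ≡⟨ inverseˡ h∈U ⟨
        (inv h∈U * h) % n   ∎))
        where
          open ≡-Reasoning
          h⁻¹gA≡A : act n ((inv h∈U * g) % n) A ≡ A
          h⁻¹gA≡A = trans (sym (act-∘ (inv∈U h∈U) g∈U A)) (trans (cong (act n (inv h∈U)) gA≡hA) (act-inv h∈U A))

  -- B = a₁ ∷ c has weight n and degree k iff weight c ≡ n - k and a₁ ≡ k - deg c.
  mult1s : ℕ → List (Sol n)
  mult1s k = map (λ c → (k ∸ deg c) ∷ c) (partitionsOf (n ∸ k))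

  length-mult1s : ∀ k → length (mult1s k) ≡ p (n ∸ k)
  length-mult1s k = trans (length-map (λ c → (k ∸ deg c) ∷ c) (partitionsOf (n ∸ k))) (length-partitionsOf (n ∸ k))

  mult1s-unique : ∀ {k} → 2 ≤ k → Unique (mult1s k)
  mult1s-unique 2≤k = Unique.map⁺ (cong tail) (partitionsOf-unique (∸-monoʳ-≤ n 2≤k))

  ∈mult1s⇔ : ∀ {k} → 2 ≤ k → k ≤ n → n ≤ k + k → ∀ B → B ∈ mult1s k ⇔ Mult1 k B
  ∈mult1s⇔ {k} 2≤k k≤n n≤2k B = mk⇔ to (from B)
    where
      t = n ∸ k
      toB : Vec ℕ n₀ → Sol n
      toB c = (k ∸ deg c) ∷ c
      t+k≡n : t + k ≡ n
      t+k≡n = m∸n+n≡m k≤n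
      t≤k : t ≤ k
      t≤k = +-cancelʳ-≤ k t k (subst (_≤ k + k) (sym t+k≡n) n≤2k)
      c∈⇔ : ∀ c → c ∈ partitionsOf t ⇔ weight c ≡ t
      c∈⇔ = ∈partitionsOf⇔ (∸-monoʳ-≤ n 2≤k)
      to : B ∈ mult1s k → Mult1 k B
      to B∈ with ∈-map⁻ toB B∈
      ... | c , c∈ , refl = mult1 (begin
          weight (toB c)                  ≡⟨ weight-∷ (k ∸ deg c) c ⟩
          k ∸ deg c + (deg c + weight c)  ≡⟨ +-assoc (k ∸ deg c) (deg c) (weight c) ⟨
          k ∸ deg c + deg c + weight c    ≡⟨ cong₂ _+_ degB≡k wc≡t ⟩
          k + t                           ≡⟨ +-comm k t ⟩
          t + k                           ≡⟨ t+k≡n ⟩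
          n                               ∎) degB≡k
        where
          open ≡-Reasoning
          wc≡t = Equivalence.to (c∈⇔ c) c∈
          degB≡k = m∸n+n≡m (≤-trans (deg≤weight c) (≤-trans (≤-reflexive wc≡t) t≤k))
      from : ∀ B → Mult1 k B → B ∈ mult1s k
      from (x ∷ c) (mult1 wB≡n degB≡k) =
        subst (_∈ mult1s k) (cong (_∷ c) k∸degc≡x) (∈-map⁺ toB (Equivalence.from (c∈⇔ c) wc≡t))
        where
          k∸degc≡x : k ∸ deg c ≡ x
          k∸degc≡x = trans (cong (_∸ deg c) (sym degB≡k)) (m+n∸n≡m x (deg c))
          wc≡t : weight c ≡ t
          wc≡t = begin
            weight c                         ≡⟨ m+n∸m≡n k (weight c) ⟨
            k + weight c ∸ k                 ≡⟨ cong (λ d → d + weight c ∸ k) degB≡k ⟨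
            x + deg c + weight c ∸ k         ≡⟨ cong (_∸ k) (+-assoc x (deg c) (weight c)) ⟩
            x + (deg c + weight c) ∸ k       ≡⟨ cong (_∸ k) (weight-∷ x c) ⟨
            weight (x ∷ c) ∸ k               ≡⟨ cong (_∸ k) wB≡n ⟩
            t                                ∎
            where open ≡-Reasoning

  module _ {k} (n+2≤2k : n + 2 ≤ k + k) where

    level1-uniqueMult1 : ∀ A → IM n k A → level n A ≡ 1 → UniqueMult1InOrbit n A
    level1-uniqueMult1 A imA ℓA≡1 =
      let B , mB , B~A = level1⇒inOrbit-mult1 A imA ℓA≡1
      in B , inOrbit-sym B B~A , weight≡n⇒mult≡1 B (Mult1.weight≡n mB) ,
         λ C A~C mC≡1 → let B~C = inOrbit-trans B B~A A~C
                            ((C∈M , _) , _) , _ = inOrbit-mult1⇒level1 mB B~C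
                        in mult1-unique n+2≤2k mB B~C (mult≡1⇒weight≡n C C∈M mC≡1)

    level1-orbitSize : ∀ A → IM n k A → level n A ≡ 1 → OrbitSize n A (φ n)
    level1-orbitSize A imA ℓA≡1 =
      let B , mB , B~A = level1⇒inOrbit-mult1 A imA ℓA≡1
      in orbit A , orbit-unique (trivialStabilizer-inOrbit (mult1-trivialStabilizer n+2≤2k mB) B~A) ,
         (λ _ → ∈orbit⇔ A) , length-orbit A

    module _ (k≤n : k ≤ n) where

      private
        2≤k : 2 ≤ k
        2≤k = m+m≤n+n⇒m≤n (≤-trans (+-monoˡ-≤ 2 (s≤s (s≤s z≤n))) n+2≤2k)

        mult1s⇔ : ∀ B → B ∈ mult1s k ⇔ Mult1 k B
        mult1s⇔ = ∈mult1s⇔ 2≤k k≤n (≤-trans (m≤m+n n 2) n+2≤2k)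

        mult1∈ : ∀ {B} → B ∈ mult1s k → Mult1 k B
        mult1∈ = Equivalence.to (mult1s⇔ _)

        ∈mult1s : ∀ {B} → Mult1 k B → B ∈ mult1s k
        ∈mult1s = Equivalence.from (mult1s⇔ _)

      level1OrbitCount : Level1OrbitCount n k (p (n ∸ k))
      level1OrbitCount =
        mult1s k ,
        All.tabulate (λ B∈ → inOrbit-mult1⇒level1 (mult1∈ B∈) (inOrbit-refl _)) ,
        AllPairs-mapWith∈
          (λ B∈ B′∈ B≢B′ B~B′ →
             B≢B′ (sym (mult1-unique n+2≤2k (mult1∈ B∈) B~B′ (Mult1.weight≡n (mult1∈ B′∈)))))
          (mult1s-unique 2≤k) ,
        (λ A imA ℓA≡1 → let B , mB , B~A = level1⇒inOrbit-mult1 A imA ℓA≡1 in lose (∈mult1s mB) B~A) ,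
        length-mult1s k

      level1Count : Level1Count n k (φ n * p (n ∸ k))
      level1Count = concatMap orbit (mult1s k) , unique , members ,
                    trans (length-concatMap-const orbit length-orbit (mult1s k)) (cong (φ n *_) (length-mult1s k))
        where
          disjoint : ∀ {B B′} → B ∈ mult1s k → B′ ∈ mult1s k → B ≢ B′ → Disjoint (orbit B) (orbit B′)
          disjoint {B} {B′} B∈ B′∈ B≢B′ (X∈B , X∈B′) = B≢B′ (sym (mult1-unique n+2≤2k (mult1∈ B∈)
            (inOrbit-trans B (Equivalence.to (∈orbit⇔ B) X∈B) (inOrbit-sym B′ (Equivalence.to (∈orbit⇔ B′) X∈B′)))
            (Mult1.weight≡n (mult1∈ B′∈))))
          unique : Unique (concatMap orbit (mult1s k))
          unique = Unique.concat⁺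
            (All.map⁺ (All.tabulate (λ B∈ → orbit-unique (mult1-trivialStabilizer n+2≤2k (mult1∈ B∈)))))
            (AllPairs.map⁺ (AllPairs-mapWith∈ disjoint (mult1s-unique 2≤k)))
          members : ∀ X → X ∈ concatMap orbit (mult1s k) ⇔ (IM n k X × level n X ≡ 1)
          members X = mk⇔
            (λ X∈ → let B , B∈ , X∈orbitB = find (∈-concatMap⁻ orbit X∈) in
                    inOrbit-mult1⇒level1 (mult1∈ B∈) (Equivalence.to (∈orbit⇔ B) X∈orbitB))
            (λ (imX , ℓX≡1) → let B , mB , B~X = level1⇒inOrbit-mult1 X imX ℓX≡1 in
                              ∈-concatMap⁺ orbit (lose (∈mult1s mB) (Equivalence.from (∈orbit⇔ B) B~X)))

  level1-theorem : ∀ {k} → n + 2 ≤ k + k → k ≤ n →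
    (∀ (A : Sol n) → IM n k A → level n A ≡ 1 → UniqueMult1InOrbit n A × OrbitSize n A (φ n))
    × Level1OrbitCount n k (p (n ∸ k))
    × Level1Count n k (φ n * p (n ∸ k))
  level1-theorem n+2≤2k k≤n =
    (λ A imA ℓA≡1 → level1-uniqueMult1 n+2≤2k A imA ℓA≡1 , level1-orbitSize n+2≤2k A imA ℓA≡1) ,
    level1OrbitCount n+2≤2k k≤n ,
    level1Count n+2≤2k k≤n

⌈n/2⌉+1≤k⇒n+2≤k+k : ∀ {n k} → ⌈ n /2⌉ + 1 ≤ k → n + 2 ≤ k + k
⌈n/2⌉+1≤k⇒n+2≤k+k {n} {k} h = begin
  n + 2                          ≡⟨ cong (_+ 2) (⌊n/2⌋+⌈n/2⌉≡n n) ⟨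
  ⌊ n /2⌋ + ⌈ n /2⌉ + 2          ≤⟨ +-monoˡ-≤ 2 (+-monoˡ-≤ ⌈ n /2⌉ (⌊n/2⌋≤⌈n/2⌉ n)) ⟩
  ⌈ n /2⌉ + ⌈ n /2⌉ + 2          ≡⟨ regroup ⌈ n /2⌉ ⟩
  (⌈ n /2⌉ + 1) + (⌈ n /2⌉ + 1)  ≤⟨ +-mono-≤ h h ⟩
  k + k                          ∎
  where
    open ≤-Reasoning
    regroup : ∀ c → c + c + 2 ≡ (c + 1) + (c + 1)
    regroup = solve-∀

⌊n/2⌋+2≤k⇒⌈n/2⌉+1≤k : ∀ {n k} → ⌊ n /2⌋ + 2 ≤ k → ⌈ n /2⌉ + 1 ≤ k
⌊n/2⌋+2≤k⇒⌈n/2⌉+1≤k {n} {k} h = begin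
  ⌈ n /2⌉ + 1            ≤⟨ +-monoˡ-≤ 1 (⌊n/2⌋-mono (n≤1+n (suc n))) ⟩
  ⌊ suc (suc n) /2⌋ + 1  ≡⟨ +-suc ⌊ n /2⌋ 1 ⟨
  ⌊ n /2⌋ + 2            ≤⟨ h ⟩
  k                      ∎
  where open ≤-Reasoning

mainTheorem1 : ∀ (n : ℕ) → 2 ≤ n →
    (∀ (k : ℕ) → ⌈ n /2⌉ + 1 ≤ k → k ≤ n →
      (∀ (A : Sol n) → IM n k A → level n A ≡ 1 →
        UniqueMult1InOrbit n A × OrbitSize n A (φ n))
      × Level1OrbitCount n k (p (n ∸ k))
      × Level1Count n k (φ n * p (n ∸ k)))
    × (∀ (k : ℕ) → ⌊ n /2⌋ + 2 ≤ k → k ≤ n → Level1OrbitCount n k (p (n ∸ k)))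
mainTheorem1 1 (s≤s ())
mainTheorem1 n@(suc (suc n₀)) _ =
  (λ k ⌈n/2⌉+1≤k k≤n → level1-theorem n₀ (⌈n/2⌉+1≤k⇒n+2≤k+k {n} ⌈n/2⌉+1≤k) k≤n) ,
  (λ k ⌊n/2⌋+2≤k k≤n →
     level1OrbitCount n₀ (⌈n/2⌉+1≤k⇒n+2≤k+k {n} (⌊n/2⌋+2≤k⇒⌈n/2⌉+1≤k {n} ⌊n/2⌋+2≤k)) k≤n)
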